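{- For every integer $n\ge 3$, the helm graph $H_n$ is Fibonacci cordial.
   Context: The Fibonacci numbers are defined by $F_0=0$, $F_1=F_2=1$, $F_n=F_{n-1}+F_{n-2}$. For a graph $G$ with $N$ vertices, a Fibonacci cordial labeling is an injective function $f:V(G)\to\{F_0,F_1,\dots,F_N\}$ (labels $F_i$ with distinct indices are regarded as distinct labels) such that the induced edge labeling $f^*(uv)=(f(u)+f(v)) \bmod 2$ satisfies $|\varepsilon_0-\varepsilon_1|\le 1$, where $\varepsilon_i$ is the number of edges labeled $i$. A graph admitting such a labeling is called Fibonacci cordial. The helm $H_n$ is obtained from the wheel with apex $v$ and rim cycle $v_1v_2\cdots v_nv_1$ by attaching a pendant vertex $u_i$ to each $v_i$ (edge $v_iu_i$); it has $2n+1$ vertices. -}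

module Defs where

open import Data.Nat using (ℕ; zero; suc; _+_; _*_; _%_; _≤_)
open import Data.Fin using (Fin; toℕ; fromℕ<; inject₁)
open import Data.List using (List; []; _∷_; map; length; filter; concatMap; upTo)
open import Data.Product using (_×_; _,_; Σ; proj₁; proj₂)
open import Relation.Binary.PropositionalEquality using (_≡_)
open import Function.Definitions using (Injective)
open import Data.Nat.Properties using (_≟_; _<?_)
open import Data.Nat.DivMod using (m%n<n)
open import Relation.Nullary using (yes; no)
open import Data.Integer using (ℤ; +_; _-_; ∣_∣)

fib : ℕ → ℕ
fib zero = 0
fib (suc zero) = 1
fib (suc (suc n)) = fib (suc n) + fib n

record Graph : Set where
  field
    N     : ℕ
    edges : List (Fin N × Fin N)
open Graph public

-- A vertex labeling by indices: f v = i means vertex v gets label F_i, i ∈ {0,…,N}.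
-- Injectivity on indices (labels F_i with distinct i are distinct labels).
Labeling : Graph → Set
Labeling G = Fin (N G) → Fin (suc (N G))

edgeLabel : (G : Graph) → Labeling G → Fin (N G) × Fin (N G) → ℕ
edgeLabel G f (u , v) = (fib (toℕ (f u)) + fib (toℕ (f v))) % 2

ε : (G : Graph) → Labeling G → ℕ → ℕ
ε G f b = length (filter (λ e → edgeLabel G f e ≟ b) (edges G))

IsFibonacciCordialLabeling : (G : Graph) → Labeling G → Set
IsFibonacciCordialLabeling G f =
  Injective _≡_ _≡_ f × ∣ (+ ε G f 0) - (+ ε G f 1) ∣ ≤ 1

FibonacciCordial : Graph → Set
FibonacciCordial G = Σ (Labeling G) (IsFibonacciCordialLabeling G)

-- Helm H_n on vertex set Fin (2n+1):
--   vertex 0 = apex v, vertex 1+i = rim vertex v_{i+1}, vertex 1+n+i = pendant u_{i+1}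
--   (i = 0,…,n-1).
-- Edges: spokes v v_i, rim cycle v_i v_{i+1} (indices mod n), pendants v_i u_i.
-- vertex with number k (k is always < 2n+1 in uses below; reduced mod 2n+1 for totality)
helmVertex : (n k : ℕ) → Fin (suc (n + n))
helmVertex n k = fromℕ< (m%n<n k (suc (n + n)))

rimNext : (n i : ℕ) → ℕ
rimNext n i with suc i <? n
... | yes _ = suc i
... | no _  = 0

helmEdgesAt : (n i : ℕ) → List (Fin (suc (n + n)) × Fin (suc (n + n)))
helmEdgesAt n i =
    (helmVertex n 0 , helmVertex n (suc i))
  ∷ (helmVertex n (suc i) , helmVertex n (suc (rimNext n i)))
  ∷ (helmVertex n (suc i) , helmVertex n (suc (n + i)))
  ∷ []

Helm : ℕ → Graph
Helm n = record { N = suc (n + n) ; edges = concatMap (helmEdgesAt n) (upTo n) }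

{-# OPTIONS --safe #-}

-- F_k is even exactly when 3 ∣ k. Give the apex F_0, and the rim vertex v_{i+1} and pendant
-- u_{i+1} the labels F_{1 + rimIndex i} and F_{1 + pendantIndex i}, where rimIndex and
-- pendantIndex share each run of twelve consecutive indices among six consecutive rim positions.
-- The label parities are then 1,1,1,1,1,0 on the rim and 1,0,0,1,1,0 on the pendants, so the
-- eighteen edges (spoke, rim edge to the next rim vertex, pendant edge) at a run of six rim
-- positions carry nine 0s and nine 1s. Hence the edge-label counts of H_{n+6} exceed those of
-- H_n by nine each, and the cases n ≤ 6 are a finite computation.

module Submission where

open import Defs
open import Data.Bool using (true; false)
open import Data.Nat using (ℕ; zero; suc; _+_; _*_; _∸_; _%_; _≤_; _<_; _≡ᵇ_; z≤n; s≤s)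
open import Data.Nat.Properties
  using (_≟_; _<?_; ≤-trans; ≤ᵇ⇒≤; ≮⇒≥; m<n⇒m<1+n; n<1+n; n≮n; m+n≮m; m+n∸m≡n; m+[n∸m]≡n;
         ∸-monoˡ-<; +-monoʳ-<; +-monoʳ-≤; m≤m+n; *-monoˡ-≤; *-comm; +-identityʳ; module ≤-Reasoning)
open import Data.Nat.DivMod using (%-distribˡ-+; m<n⇒m%n≡m)
open import Data.Fin using (Fin; toℕ; fromℕ<)
open import Data.Fin.Properties using (toℕ-fromℕ<; toℕ-injective; toℕ<n)
open import Data.List using (List; []; _∷_; [_]; _++_; _∷ʳ_; map; length; filter; concat; concatMap; upTo)
open import Data.List.Properties
  using (map-concatMap; concatMap-++; map-cong-local; upTo-∷ʳ; map-upTo; map-applyUpTo; filter-++; length-++)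
open import Data.List.Relation.Unary.All.Properties using (applyUpTo⁺₁)
open import Data.Integer using (+_; _-_; _⊖_; ∣_∣)
open import Data.Integer.Properties using (m-n≡m⊖n; +-cancelˡ-⊖)
open import Data.Product using (_×_; _,_)
open import Data.Unit using (⊤; tt)
open import Function using (id; _∘_)
open import Function.Definitions using (Injective)
open import Relation.Binary.PropositionalEquality using (_≡_; refl; sym; trans; cong; cong₂; subst; subst₂; module ≡-Reasoning)
open import Relation.Nullary using (yes; no)
open import Relation.Nullary.Negation using (contradiction)

fibParity : ℕ → ℕ
fibParity 0 = 0
fibParity 1 = 1
fibParity 2 = 1
fibParity (suc (suc (suc k))) = fibParity k

fibParity-rec : ∀ k → (fibParity (suc k) + fibParity k) % 2 ≡ fibParity (suc (suc k))
fibParity-rec 0 = refl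
fibParity-rec 1 = refl
fibParity-rec 2 = refl
fibParity-rec (suc (suc (suc k))) = fibParity-rec k

fib%2≡fibParity : ∀ k → fib k % 2 ≡ fibParity k
fib%2≡fibParity 0 = refl
fib%2≡fibParity 1 = refl
fib%2≡fibParity (suc (suc k)) = begin
  (fib (suc k) + fib k) % 2                ≡⟨ %-distribˡ-+ (fib (suc k)) (fib k) 2 ⟩
  (fib (suc k) % 2 + fib k % 2) % 2        ≡⟨ cong₂ (λ a b → (a + b) % 2) (fib%2≡fibParity (suc k)) (fib%2≡fibParity k) ⟩
  (fibParity (suc k) + fibParity k) % 2    ≡⟨ fibParity-rec k ⟩
  fibParity (suc (suc k))                  ∎
  where open ≡-Reasoning

[fib+fib]%2≡[fibParity+fibParity]%2 : ∀ a b → (fib a + fib b) % 2 ≡ (fibParity a + fibParity b) % 2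
[fib+fib]%2≡[fibParity+fibParity]%2 a b =
  trans (%-distribˡ-+ (fib a) (fib b) 2) (cong₂ (λ x y → (x + y) % 2) (fib%2≡fibParity a) (fib%2≡fibParity b))

data HelmVertex : Set where
  apex         : HelmVertex
  rim pendant  : ℕ → HelmVertex

InHelm : ℕ → HelmVertex → Set
InHelm n apex        = ⊤
InHelm n (rim i)     = i < n
InHelm n (pendant i) = i < n

vertexNumber : ℕ → HelmVertex → ℕ
vertexNumber n apex        = 0
vertexNumber n (rim i)     = suc i
vertexNumber n (pendant i) = suc (n + i)

vertexAt : ℕ → ℕ → HelmVertex
vertexAt n zero = apex
vertexAt n (suc k) with k <? n
... | yes _ = rim k
... | no  _ = pendant (k ∸ n)

vertexNumber-vertexAt : ∀ n k → vertexNumber n (vertexAt n k) ≡ k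
vertexNumber-vertexAt n zero = refl
vertexNumber-vertexAt n (suc k) with k <? n
... | yes _   = refl
... | no  k≮n = cong suc (m+[n∸m]≡n (≮⇒≥ k≮n))

vertexAt-vertexNumber : ∀ {n} v → InHelm n v → vertexAt n (vertexNumber n v) ≡ v
vertexAt-vertexNumber apex _ = refl
vertexAt-vertexNumber {n} (rim i) i<n with i <? n
... | yes _   = refl
... | no  i≮n = contradiction i<n i≮n
vertexAt-vertexNumber {n} (pendant i) _ with n + i <? n
... | yes n+i<n = contradiction n+i<n (m+n≮m n i)
... | no  _     = cong pendant (m+n∸m≡n n i)

vertexAt-inHelm : ∀ n k → k < suc (n + n) → InHelm n (vertexAt n k)
vertexAt-inHelm n zero _ = tt
vertexAt-inHelm n (suc k) (s≤s k<n+n) with k <? n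
... | yes k<n = k<n
... | no  k≮n = subst (k ∸ n <_) (m+n∸m≡n n n) (∸-monoˡ-< k<n+n (≮⇒≥ k≮n))

vertexNumber-< : ∀ {n} v → InHelm n v → vertexNumber n v < suc (n + n)
vertexNumber-< apex        _   = s≤s z≤n
vertexNumber-< {n} (rim i)     i<n = s≤s (≤-trans i<n (m≤m+n n n))
vertexNumber-< {n} (pendant i) i<n = s≤s (+-monoʳ-< n i<n)

rimIndex : ℕ → ℕ
rimIndex 0 = 0
rimIndex 1 = 3
rimIndex 2 = 4
rimIndex 3 = 6
rimIndex 4 = 9
rimIndex 5 = 8
rimIndex (suc (suc (suc (suc (suc (suc i)))))) = 12 + rimIndex i

pendantIndex : ℕ → ℕ
pendantIndex 0 = 1
pendantIndex 1 = 2
pendantIndex 2 = 5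
pendantIndex 3 = 7
pendantIndex 4 = 10
pendantIndex 5 = 11
pendantIndex (suc (suc (suc (suc (suc (suc i)))))) = 12 + pendantIndex i

rimIndex-≤ : ∀ i → rimIndex i ≤ suc i * 2
rimIndex-≤ 0 = ≤ᵇ⇒≤ _ _ _
rimIndex-≤ 1 = ≤ᵇ⇒≤ _ _ _
rimIndex-≤ 2 = ≤ᵇ⇒≤ _ _ _
rimIndex-≤ 3 = ≤ᵇ⇒≤ _ _ _
rimIndex-≤ 4 = ≤ᵇ⇒≤ _ _ _
rimIndex-≤ 5 = ≤ᵇ⇒≤ _ _ _
rimIndex-≤ (suc (suc (suc (suc (suc (suc i)))))) = +-monoʳ-≤ 12 (rimIndex-≤ i)

pendantIndex-≤ : ∀ i → pendantIndex i ≤ suc i * 2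
pendantIndex-≤ 0 = ≤ᵇ⇒≤ _ _ _
pendantIndex-≤ 1 = ≤ᵇ⇒≤ _ _ _
pendantIndex-≤ 2 = ≤ᵇ⇒≤ _ _ _
pendantIndex-≤ 3 = ≤ᵇ⇒≤ _ _ _
pendantIndex-≤ 4 = ≤ᵇ⇒≤ _ _ _
pendantIndex-≤ 5 = ≤ᵇ⇒≤ _ _ _
pendantIndex-≤ (suc (suc (suc (suc (suc (suc i)))))) = +-monoʳ-≤ 12 (pendantIndex-≤ i)

labelIndex : HelmVertex → ℕ
labelIndex apex        = 0
labelIndex (rim i)     = suc (rimIndex i)
labelIndex (pendant i) = suc (pendantIndex i)

shift6 : HelmVertex → HelmVertex
shift6 apex        = apex
shift6 (rim i)     = rim (6 + i)
shift6 (pendant i) = pendant (6 + i)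

vertexOfLabelIndex : ℕ → HelmVertex
vertexOfLabelIndex 0  = apex
vertexOfLabelIndex 1  = rim 0
vertexOfLabelIndex 2  = pendant 0
vertexOfLabelIndex 3  = pendant 1
vertexOfLabelIndex 4  = rim 1
vertexOfLabelIndex 5  = rim 2
vertexOfLabelIndex 6  = pendant 2
vertexOfLabelIndex 7  = rim 3
vertexOfLabelIndex 8  = pendant 3
vertexOfLabelIndex 9  = rim 5
vertexOfLabelIndex 10 = rim 4
vertexOfLabelIndex 11 = pendant 4
vertexOfLabelIndex 12 = pendant 5
vertexOfLabelIndex (suc (suc (suc (suc (suc (suc (suc (suc (suc (suc (suc (suc (suc j))))))))))))) =
  shift6 (vertexOfLabelIndex (suc j))

vertexOfLabelIndex-labelIndex : ∀ v → vertexOfLabelIndex (labelIndex v) ≡ v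
vertexOfLabelIndex-labelIndex apex        = refl
vertexOfLabelIndex-labelIndex (rim 0)     = refl
vertexOfLabelIndex-labelIndex (rim 1)     = refl
vertexOfLabelIndex-labelIndex (rim 2)     = refl
vertexOfLabelIndex-labelIndex (rim 3)     = refl
vertexOfLabelIndex-labelIndex (rim 4)     = refl
vertexOfLabelIndex-labelIndex (rim 5)     = refl
vertexOfLabelIndex-labelIndex (rim (suc (suc (suc (suc (suc (suc i))))))) =
  cong shift6 (vertexOfLabelIndex-labelIndex (rim i))
vertexOfLabelIndex-labelIndex (pendant 0) = refl
vertexOfLabelIndex-labelIndex (pendant 1) = refl
vertexOfLabelIndex-labelIndex (pendant 2) = refl
vertexOfLabelIndex-labelIndex (pendant 3) = refl
vertexOfLabelIndex-labelIndex (pendant 4) = refl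
vertexOfLabelIndex-labelIndex (pendant 5) = refl
vertexOfLabelIndex-labelIndex (pendant (suc (suc (suc (suc (suc (suc i))))))) =
  cong shift6 (vertexOfLabelIndex-labelIndex (pendant i))

≤-double : ∀ {j i n} → j ≤ suc i * 2 → i < n → j ≤ n + n
≤-double {j} {i} {n} j≤ i<n = begin
  j            ≤⟨ j≤ ⟩
  suc i * 2    ≤⟨ *-monoˡ-≤ 2 i<n ⟩
  n * 2        ≡⟨ *-comm n 2 ⟩
  n + (n + 0)  ≡⟨ cong (λ m → n + m) (+-identityʳ n) ⟩
  n + n        ∎
  where open ≤-Reasoning

labelIndex-< : ∀ {n} v → InHelm n v → labelIndex v < suc (suc (n + n))
labelIndex-< apex        _   = s≤s z≤n
labelIndex-< (rim i)     i<n = s≤s (s≤s (≤-double (rimIndex-≤ i) i<n))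
labelIndex-< (pendant i) i<n = s≤s (s≤s (≤-double (pendantIndex-≤ i) i<n))

helmLabeling : (n : ℕ) → Labeling (Helm n)
helmLabeling n v = fromℕ< (labelIndex-< (vertexAt n (toℕ v)) (vertexAt-inHelm n (toℕ v) (toℕ<n v)))

toℕ-helmLabeling : ∀ n v → toℕ (helmLabeling n v) ≡ labelIndex (vertexAt n (toℕ v))
toℕ-helmLabeling n v = toℕ-fromℕ< _

vertexNumberOfLabel-helmLabeling : ∀ n v →
  vertexNumber n (vertexOfLabelIndex (toℕ (helmLabeling n v))) ≡ toℕ v
vertexNumberOfLabel-helmLabeling n v = begin
  vertexNumber n (vertexOfLabelIndex (toℕ (helmLabeling n v)))
    ≡⟨ cong (vertexNumber n ∘ vertexOfLabelIndex) (toℕ-helmLabeling n v) ⟩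
  vertexNumber n (vertexOfLabelIndex (labelIndex (vertexAt n (toℕ v))))
    ≡⟨ cong (vertexNumber n) (vertexOfLabelIndex-labelIndex (vertexAt n (toℕ v))) ⟩
  vertexNumber n (vertexAt n (toℕ v))
    ≡⟨ vertexNumber-vertexAt n (toℕ v) ⟩
  toℕ v ∎
  where open ≡-Reasoning

helmLabeling-injective : ∀ n → Injective _≡_ _≡_ (helmLabeling n)
helmLabeling-injective n {v} {w} eq = toℕ-injective (begin
  toℕ v                                                         ≡⟨ vertexNumberOfLabel-helmLabeling n v ⟨
  vertexNumber n (vertexOfLabelIndex (toℕ (helmLabeling n v)))  ≡⟨ cong (vertexNumber n ∘ vertexOfLabelIndex ∘ toℕ) eq ⟩
  vertexNumber n (vertexOfLabelIndex (toℕ (helmLabeling n w)))  ≡⟨ vertexNumberOfLabel-helmLabeling n w ⟩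
  toℕ w                                                         ∎)
  where open ≡-Reasoning

edgeParity : HelmVertex → HelmVertex → ℕ
edgeParity v w = (fibParity (labelIndex v) + fibParity (labelIndex w)) % 2

edgeLabel-helm : ∀ {n} v w → InHelm n v → InHelm n w →
  edgeLabel (Helm n) (helmLabeling n) (helmVertex n (vertexNumber n v) , helmVertex n (vertexNumber n w))
    ≡ edgeParity v w
edgeLabel-helm {n} v w v∈ w∈ = begin
  (fib (toℕ (helmLabeling n (helmVertex n (vertexNumber n v))))
    + fib (toℕ (helmLabeling n (helmVertex n (vertexNumber n w))))) % 2
    ≡⟨ cong₂ (λ a b → (fib a + fib b) % 2) (labelOf v v∈) (labelOf w w∈) ⟩
  (fib (labelIndex v) + fib (labelIndex w)) % 2
    ≡⟨ [fib+fib]%2≡[fibParity+fibParity]%2 (labelIndex v) (labelIndex w) ⟩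
  edgeParity v w ∎
  where
  open ≡-Reasoning
  labelOf : ∀ u → InHelm n u → toℕ (helmLabeling n (helmVertex n (vertexNumber n u))) ≡ labelIndex u
  labelOf u u∈ = begin
    toℕ (helmLabeling n (helmVertex n (vertexNumber n u)))
      ≡⟨ toℕ-helmLabeling n (helmVertex n (vertexNumber n u)) ⟩
    labelIndex (vertexAt n (toℕ (helmVertex n (vertexNumber n u))))
      ≡⟨ cong (labelIndex ∘ vertexAt n) (trans (toℕ-fromℕ< _) (m<n⇒m%n≡m (vertexNumber-< u u∈))) ⟩
    labelIndex (vertexAt n (vertexNumber n u))
      ≡⟨ cong labelIndex (vertexAt-vertexNumber u u∈) ⟩
    labelIndex u ∎

rimNext-< : ∀ {n i} → i < n → rimNext n i < n
rimNext-< {n} {i} i<n with suc i <? n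
... | yes i+1<n = i+1<n
... | no  _     = ≤-trans (s≤s z≤n) i<n

rimNext-suc : ∀ {m i} → i < m → rimNext (suc m) i ≡ suc i
rimNext-suc {m} {i} i<m with suc i <? suc m
... | yes _     = refl
... | no  i+1≮  = contradiction (s≤s i<m) i+1≮

rimNext-last : ∀ m → rimNext (suc m) m ≡ 0
rimNext-last m with suc m <? suc m
... | yes m+1<m+1 = contradiction m+1<m+1 (n≮n (suc m))
... | no  _       = refl

blockLabels : ℕ → ℕ → List ℕ
blockLabels i j = edgeParity apex (rim i) ∷ edgeParity (rim i) (rim j) ∷ edgeParity (rim i) (pendant i) ∷ []

edgeLabels-helmEdgesAt : ∀ {n i} → i < n →
  map (edgeLabel (Helm n) (helmLabeling n)) (helmEdgesAt n i) ≡ blockLabels i (rimNext n i)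
edgeLabels-helmEdgesAt {n} {i} i<n =
  cong₂ _∷_ (edgeLabel-helm apex (rim i) tt i<n)
    (cong₂ _∷_ (edgeLabel-helm (rim i) (rim (rimNext n i)) i<n (rimNext-< i<n))
      (cong₂ _∷_ (edgeLabel-helm (rim i) (pendant i) i<n i<n) refl))

helmLabels : ℕ → List ℕ
helmLabels m = concatMap (λ i → blockLabels i (suc i)) (upTo m) ++ blockLabels m 0

edgeLabels-Helm : ∀ m → map (edgeLabel (Helm (suc m)) (helmLabeling (suc m))) (edges (Helm (suc m))) ≡ helmLabels m
edgeLabels-Helm m = begin
  map F (concatMap E (upTo (suc m)))                  ≡⟨ cong (map F ∘ concatMap E) (upTo-∷ʳ m) ⟨
  map F (concatMap E (upTo m ∷ʳ m))                   ≡⟨ map-concatMap F E (upTo m ∷ʳ m) ⟩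
  concatMap (map F ∘ E) (upTo m ∷ʳ m)                 ≡⟨ concatMap-++ (map F ∘ E) (upTo m) [ m ] ⟩
  concatMap (map F ∘ E) (upTo m) ++ map F (E m) ++ [] ≡⟨ cong₂ _++_ openBlocks (cong (_++ []) closingBlock) ⟩
  helmLabels m                                        ∎
  where
  open ≡-Reasoning
  F : Fin (N (Helm (suc m))) × Fin (N (Helm (suc m))) → ℕ
  F = edgeLabel (Helm (suc m)) (helmLabeling (suc m))
  E : ℕ → List (Fin (N (Helm (suc m))) × Fin (N (Helm (suc m))))
  E = helmEdgesAt (suc m)
  openBlocks : concatMap (map F ∘ E) (upTo m) ≡ concatMap (λ i → blockLabels i (suc i)) (upTo m)
  openBlocks = cong concat (map-cong-local (applyUpTo⁺₁ id m λ {i} i<m →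
    trans (edgeLabels-helmEdgesAt (m<n⇒m<1+n i<m)) (cong (blockLabels i) (rimNext-suc i<m))))
  closingBlock : map F (E m) ≡ blockLabels m 0
  closingBlock = trans (edgeLabels-helmEdgesAt (n<1+n m)) (cong (blockLabels m) (rimNext-last m))

-- blockLabels (6 + i) (6 + j) computes to blockLabels i j: rimIndex and pendantIndex advance
-- by 12 and fibParity has period 3.
helmLabels-6+ : ∀ m → helmLabels (6 + m) ≡ concatMap (λ i → blockLabels i (suc i)) (upTo 6) ++ helmLabels m
helmLabels-6+ m =
  cong (λ xs → concatMap f (upTo 6) ++ concat xs ++ blockLabels m 0)
    (trans (map-applyUpTo (λ i → 6 + i) f m) (sym (map-upTo f m)))
  where
  f : ℕ → List ℕ
  f i = blockLabels i (suc i)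

count : ℕ → List ℕ → ℕ
count b xs = length (filter (_≟ b) xs)

count-map : ∀ {A : Set} (f : A → ℕ) b xs → length (filter (λ x → f x ≟ b) xs) ≡ count b (map f xs)
count-map f b []       = refl
-- filter's test does (f x ≟ b) computes to f x ≡ᵇ b.
count-map f b (x ∷ xs) with f x ≡ᵇ b
... | true  = cong suc (count-map f b xs)
... | false = count-map f b xs

count-++ : ∀ b xs ys → count b (xs ++ ys) ≡ count b xs + count b ys
count-++ b xs ys = trans (cong length (filter-++ (_≟ b) xs ys)) (length-++ (filter (_≟ b) xs))

Balanced : ℕ → ℕ → Set
Balanced a c = ∣ + a - + c ∣ ≤ 1

Balanced-+ : ∀ k {a c} → Balanced a c → Balanced (k + a) (k + c)
Balanced-+ k {a} {c} = subst (_≤ 1) (cong ∣_∣ (begin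
  + a - + c             ≡⟨ m-n≡m⊖n a c ⟩
  a ⊖ c                 ≡⟨ +-cancelˡ-⊖ k a c ⟨
  (k + a) ⊖ (k + c)     ≡⟨ m-n≡m⊖n (k + a) (k + c) ⟨
  + (k + a) - + (k + c) ∎))
  where open ≡-Reasoning

CountsBalanced : List ℕ → Set
CountsBalanced xs = Balanced (count 0 xs) (count 1 xs)

CountsBalanced-++ : ∀ xs ys → count 0 xs ≡ count 1 xs → CountsBalanced ys → CountsBalanced (xs ++ ys)
CountsBalanced-++ xs ys eq bal =
  subst₂ Balanced (sym (count-++ 0 xs ys)) (sym (count-++ 1 xs ys))
    (subst (λ k → Balanced (count 0 xs + count 0 ys) (k + count 1 ys)) eq (Balanced-+ (count 0 xs) bal))

helmLabels-balanced : ∀ m → CountsBalanced (helmLabels m)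
helmLabels-balanced 0 = ≤ᵇ⇒≤ _ _ _
helmLabels-balanced 1 = ≤ᵇ⇒≤ _ _ _
helmLabels-balanced 2 = ≤ᵇ⇒≤ _ _ _
helmLabels-balanced 3 = ≤ᵇ⇒≤ _ _ _
helmLabels-balanced 4 = ≤ᵇ⇒≤ _ _ _
helmLabels-balanced 5 = ≤ᵇ⇒≤ _ _ _
helmLabels-balanced (suc (suc (suc (suc (suc (suc m)))))) =
  subst CountsBalanced (sym (helmLabels-6+ m))
    (CountsBalanced-++ (concatMap (λ i → blockLabels i (suc i)) (upTo 6)) (helmLabels m) refl (helmLabels-balanced m))

helmLabeling-balanced : ∀ n → Balanced (ε (Helm n) (helmLabeling n) 0) (ε (Helm n) (helmLabeling n) 1)
helmLabeling-balanced zero    = z≤n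
helmLabeling-balanced (suc m) =
  subst₂ Balanced (sym (ε≡count 0)) (sym (ε≡count 1)) (helmLabels-balanced m)
  where
  ε≡count : ∀ b → ε (Helm (suc m)) (helmLabeling (suc m)) b ≡ count b (helmLabels m)
  ε≡count b = trans (count-map (edgeLabel (Helm (suc m)) (helmLabeling (suc m))) b (edges (Helm (suc m)))) (cong (count b) (edgeLabels-Helm m))

helm-fibonacciCordial : ∀ n → FibonacciCordial (Helm n)
helm-fibonacciCordial n = helmLabeling n , helmLabeling-injective n , helmLabeling-balanced n

-- The labeling works for every n; the hypothesis 3 ≤ n only excludes degenerate helms.
mainTheorem2 : (n : ℕ) → 3 ≤ n → FibonacciCordial (Helm n)
mainTheorem2 n _ = helm-fibonacciCordial n
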